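{- Let $n\ge3$ and let $P=(A_0,\dots,A_N)$ be a monotone weakly separated path of $3$-subsets of $[n]$ from $A_0=\{1,2,3\}$ to $A_N=\{n-2,n-1,n\}$. Then the bicolored arc diagram $\mathbf{BiD}(P)$ is a simple graph: every pair of distinct vertices $i,j\in[n]$ is joined by exactly one black edge, or by exactly one red edge, or by no edge.
   Context: Two different $k$-subsets $I,J$ are weakly separated if $\max(I\setminus J)<\min(J\setminus I)$ or $\max(J\setminus I)<\min(I\setminus J)$. A monotone weakly separated path is a sequence $(A_0,\dots,A_N)$ of $k$-subsets, pairwise weakly separated, such that for each $i$, $A_i\setminus A_{i-1}=\{x_i\}$, $A_{i-1}\setminus A_i=\{y_i\}$ with $x_i>y_i$. For $i\in[N]$ let $C_i=(A_i\setminus A_{i-1})\cup(A_{i-1}\setminus A_i)$ (a $2$-element set). The arc diagram $\mathbf{D}(P)$ is the simple graph on $[n]$ whose edges are the pairs $C_1,\dots,C_N$. The bicolored arc diagram $\mathbf{BiD}(P)$ is the multigraph on $[n]$ whose black edges are the edges of $\mathbf{D}(P)$ and whose red edges are added as follows: for each $j=1,\dots,N-1$, writing $C_j=\{a,b\}$ with $a<b$ and $C_{j+1}=\{c,d\}$ with $c<d$, add a red edge $\{b,c\}$ if $b\ne c$ and a red edge $\{a,d\}$ if $a\ne d$. -}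

module Defs where

open import Data.Nat as ℕ using (ℕ; zero; suc; _∸_; _<ᵇ_; _≤ᵇ_)
open import Data.Fin as Fin using (Fin; toℕ)
open import Data.Fin.Subset using (Subset; _∈_; _─_; ⁅_⁆; ∣_∣)
open import Data.Vec using (tabulate)
open import Data.Bool using (Bool; true; false; _∧_; _∨_; if_then_else_)
open import Data.List using (List; []; _∷_; _++_; map; upTo)
open import Data.Product using (_×_; _,_)
open import Data.Sum using (_⊎_)
open import Relation.Nullary.Decidable using (⌊_⌋)
open import Relation.Binary.PropositionalEquality using (_≡_; _≢_)

-- Convention: [n] = {1,…,n} is modelled by Fin n, the element i : Fin n
-- standing for toℕ i + 1.  The order is the usual one on Fin n.

IsKSubset : {n : ℕ} → ℕ → Subset n → Set
IsKSubset k S = ∣ S ∣ ≡ k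

-- max (I ∖ J) < min (J ∖ I), written out over the elements
-- (for nonempty finite sets this is what the max/min comparison unfolds to)
MaxLtMin : {n : ℕ} → Subset n → Subset n → Set
MaxLtMin {n} I J = (a b : Fin n) → a ∈ I ─ J → b ∈ J ─ I → a Fin.< b

WeaklySeparated : {n : ℕ} → Subset n → Subset n → Set
WeaklySeparated I J = MaxLtMin I J ⊎ MaxLtMin J I

-- {1,2,3} and {n-2,n-1,n}  (in 0-based Fin encoding: {0,1,2} and {n-3,n-2,n-1})
initial3 : (n : ℕ) → Subset n
initial3 n = tabulate (λ i → toℕ i <ᵇ 3)

final3 : (n : ℕ) → Subset n
final3 n = tabulate (λ i → (n ∸ 3) ≤ᵇ toℕ i)

record MonotoneWSPath (n k N : ℕ) (A : ℕ → Subset n) (x y : ℕ → Fin n) : Set where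
  field
    ksubset   : (i : ℕ) → i ℕ.≤ N → IsKSubset k (A i)
    pairwiseWS : (i j : ℕ) → i ℕ.≤ N → j ℕ.≤ N → WeaklySeparated (A i) (A j)
    stepIn    : (i : ℕ) → 1 ℕ.≤ i → i ℕ.≤ N → A i ─ A (i ∸ 1) ≡ ⁅ x i ⁆
    stepOut   : (i : ℕ) → 1 ℕ.≤ i → i ℕ.≤ N → A (i ∸ 1) ─ A i ≡ ⁅ y i ⁆
    stepUp    : (i : ℕ) → 1 ℕ.≤ i → i ℕ.≤ N → y i Fin.< x i

-- Edges as ordered pairs of vertices, understood as unordered edges.
Edge : ℕ → Set
Edge n = Fin n × Fin n

range1 : ℕ → List ℕ
range1 m = map suc (upTo m)

-- Black edges: C_i = {y i, x i} for i = 1..N  (as a list; D(P) is the simple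
-- graph on these pairs, so only membership matters for black edges).
blackEdges : {n : ℕ} → ℕ → (ℕ → Fin n) → (ℕ → Fin n) → List (Edge n)
blackEdges N x y = map (λ i → (y i , x i)) (range1 N)

-- Red edges (with multiplicity): for j = 1..N-1, with C_j = {a<b} = {y j, x j}
-- and C_{j+1} = {c<d} = {y (j+1), x (j+1)}: add {b,c} if b ≠ c and {a,d} if a ≠ d.
redAt : {n : ℕ} → (ℕ → Fin n) → (ℕ → Fin n) → ℕ → List (Edge n)
redAt x y j =
  (if ⌊ x j Fin.≟ y (suc j) ⌋ then [] else (x j , y (suc j)) ∷ [])
  ++ (if ⌊ y j Fin.≟ x (suc j) ⌋ then [] else (y j , x (suc j)) ∷ [])

concatMapL : {A B : Set} → (A → List B) → List A → List B
concatMapL f [] = []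
concatMapL f (a ∷ as) = f a ++ concatMapL f as

redEdges : {n : ℕ} → ℕ → (ℕ → Fin n) → (ℕ → Fin n) → List (Edge n)
redEdges N x y = concatMapL (redAt x y) (range1 (N ∸ 1))

joins : {n : ℕ} → Edge n → Fin n → Fin n → Bool
joins (a , b) u v =
  (⌊ a Fin.≟ u ⌋ ∧ ⌊ b Fin.≟ v ⌋) ∨ (⌊ a Fin.≟ v ⌋ ∧ ⌊ b Fin.≟ u ⌋)

multiplicity : {n : ℕ} → List (Edge n) → Fin n → Fin n → ℕ
multiplicity [] u v = 0
multiplicity (e ∷ es) u v =
  (if joins e u v then 1 else 0) ℕ.+ multiplicity es u v

-- number of black edges of BiD(P) between u and v: D(P) is a simple graph,
-- so this is 1 if {u,v} is some C_i and 0 otherwise.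
blackMult : {n : ℕ} → ℕ → (ℕ → Fin n) → (ℕ → Fin n) → Fin n → Fin n → ℕ
blackMult N x y u v with multiplicity (blackEdges N x y) u v
... | zero = 0
... | suc _ = 1

redMult : {n : ℕ} → ℕ → (ℕ → Fin n) → (ℕ → Fin n) → Fin n → Fin n → ℕ
redMult N x y u v = multiplicity (redEdges N x y) u v

BiDSimple : (n N : ℕ) → (ℕ → Fin n) → (ℕ → Fin n) → Set
BiDSimple n N x y =
  (u v : Fin n) → u ≢ v →
    (blackMult N x y u v ≡ 1 × redMult N x y u v ≡ 0)
    ⊎ (blackMult N x y u v ≡ 0 × redMult N x y u v ≡ 1)
    ⊎ (blackMult N x y u v ≡ 0 × redMult N x y u v ≡ 0)

-- Every edge of BiD(P) comes from an exchange in the path: the black edge C i trades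
-- y i for x i over the interval [i-1, i], and a red edge added at j trades an element of
-- C j for one of C (j+1) over [j-1, j+1], the two being together in or out of A j.
-- Since each step replaces an element by a larger one, the number of elements ≥ q of
-- A t grows with t; together with weak separation this forbids ever trading an element
-- for a smaller one, and it follows that the unordered pair {u, v} determines the
-- interval of any exchange between u and v. Two edges between u and v would thus share
-- their interval, which is impossible for a black and a red edge, for red edges added at
-- different j, and for the two red edges added at the same j.
module Submission where

open import Defs
open import Data.Nat using (ℕ; _≤_)
open import Data.Fin using (Fin)
open import Data.Fin.Subset using (Subset)
open import Relation.Binary.PropositionalEquality using (_≡_)

open import Data.Bool using (T; true; false; _∧_; _∨_; if_then_else_)
open import Data.Bool.Properties using (T-≡; T-∧; T-∨; ∧-comm; ∨-comm)
open import Data.Empty using (⊥; ⊥-elim)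
open import Data.Fin as Fin using (zero; suc)
import Data.Fin.Properties as Fin
open import Data.Fin.Subset
  using (_∈_; _∉_; _⊆_; _⊂_; _∩_; _─_; ⁅_⁆; ∣_∣; inside; outside; ⊤)
open import Data.Fin.Subset.Properties
  using (_∈?_; drop-there; ∈⊤; x∈⁅x⁆; x∈⁅y⁆⇒x≡y; ∣⁅x⁆∣≡1; p⊆q⇒∣p∣≤∣q∣;
         p⊂q⇒∣p∣<∣q∣; x∈p∩q⁺; x∈p∩q⁻; ∣p∩q∣≤∣q∣; x∈p∧x∉q⇒x∈p─q; p─q⊆p)
open import Data.List using (List; []; _∷_; _++_; map; upTo)
open import Data.Nat.ListAction using (sum)
open import Data.List.Properties using (map-∘)
open import Data.List.Relation.Unary.All as All using (All; []; _∷_; lookupAny)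
open import Data.List.Relation.Unary.Any as Any using (Any)
open import Data.List.Relation.Unary.Unique.Propositional using (Unique)
open import Data.List.Relation.Unary.AllPairs using ([]; _∷_)
open import Data.List.Relation.Unary.Unique.Propositional.Properties using (upTo⁺)
open import Data.List.Membership.Propositional.Properties using (∈-upTo⁻)
open import Data.Nat using (zero; suc; _+_; _<_; _∸_; z≤n; s≤s; z<s)
open import Data.Nat.Properties
open import Data.Product as Product using (_×_; _,_; proj₁; proj₂)
open import Data.Sum as Sum using (_⊎_; inj₁; inj₂; [_,_])
import Data.Vec as Vec
open Vec using (_∷_; here; there)
open import Function using (_∘_; _⇔_; mk⇔; Equivalence)
open import Relation.Binary.Definitions using (tri<; tri≈; tri>)
open import Relation.Binary.PropositionalEquality
  using (_≢_; refl; sym; trans; cong; cong₂; subst; ≢-sym)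
open import Relation.Nullary using (¬_; Dec; yes; no; contradiction)
open import Relation.Nullary.Decidable using (⌊_⌋; toWitness)

private
  variable
    m : ℕ

x∈p─q⇒x∉q : ∀ {x : Fin m} (p q : Subset m) → x ∈ p ─ q → x ∉ q
x∈p─q⇒x∉q (_ ∷ p) (outside ∷ q) here = λ ()
x∈p─q⇒x∉q {x = zero} (_ ∷ p) (inside ∷ q) ()
x∈p─q⇒x∉q (_ ∷ p) (_ ∷ q) (there x∈p─q) = x∈p─q⇒x∉q p q x∈p─q ∘ drop-there

∣∩─∣-exchange : (U S T : Subset m) →
                ∣ U ∩ S ∣ + ∣ U ∩ (T ─ S) ∣ ≡ ∣ U ∩ T ∣ + ∣ U ∩ (S ─ T) ∣
∣∩─∣-exchange Vec.[] Vec.[] Vec.[] = refl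
∣∩─∣-exchange (outside ∷ U) (_ ∷ S) (_ ∷ T) = ∣∩─∣-exchange U S T
∣∩─∣-exchange (inside ∷ U) (inside ∷ S) (inside ∷ T) = cong suc (∣∩─∣-exchange U S T)
∣∩─∣-exchange (inside ∷ U) (inside ∷ S) (outside ∷ T) =
  trans (cong suc (∣∩─∣-exchange U S T)) (sym (+-suc _ _))
∣∩─∣-exchange (inside ∷ U) (outside ∷ S) (inside ∷ T) =
  trans (+-suc _ _) (cong suc (∣∩─∣-exchange U S T))
∣∩─∣-exchange (inside ∷ U) (outside ∷ S) (outside ∷ T) = ∣∩─∣-exchange U S T

UpwardClosed : Subset m → Set
UpwardClosed U = ∀ {a b} → a Fin.≤ b → a ∈ U → b ∈ U

∣∩⁅⁆∣-mono : ∀ {U : Subset m} {a b} → UpwardClosed U → a Fin.≤ b → ∣ U ∩ ⁅ a ⁆ ∣ ≤ ∣ U ∩ ⁅ b ⁆ ∣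
∣∩⁅⁆∣-mono {U = U} {a = a} {b = b} up a≤b with a ∈? U
... | yes a∈U = begin
  ∣ U ∩ ⁅ a ⁆ ∣  ≤⟨ ∣p∩q∣≤∣q∣ U ⁅ a ⁆ ⟩
  ∣ ⁅ a ⁆ ∣      ≡⟨ trans (∣⁅x⁆∣≡1 a) (sym (∣⁅x⁆∣≡1 b)) ⟩
  ∣ ⁅ b ⁆ ∣      ≤⟨ p⊆q⇒∣p∣≤∣q∣ ⁅b⁆⊆U∩⁅b⁆ ⟩
  ∣ U ∩ ⁅ b ⁆ ∣  ∎
  where
  open ≤-Reasoning
  ⁅b⁆⊆U∩⁅b⁆ : ⁅ b ⁆ ⊆ U ∩ ⁅ b ⁆
  ⁅b⁆⊆U∩⁅b⁆ z∈⁅b⁆ = x∈p∩q⁺ (subst (_∈ U) (sym (x∈⁅y⁆⇒x≡y b z∈⁅b⁆)) (up a≤b a∈U) , z∈⁅b⁆)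
... | no a∉U = p⊆q⇒∣p∣≤∣q∣ {q = U ∩ ⁅ b ⁆} (⊥-elim ∘ a∉U ∘ z∈U∩⁅a⁆⇒a∈U)
  where
  z∈U∩⁅a⁆⇒a∈U : ∀ {z} → z ∈ U ∩ ⁅ a ⁆ → a ∈ U
  z∈U∩⁅a⁆⇒a∈U z∈ with z∈U , z∈⁅a⁆ ← x∈p∩q⁻ U ⁅ a ⁆ z∈ = subst (_∈ U) (x∈⁅y⁆⇒x≡y a z∈⁅a⁆) z∈U

∣∩∣-mono-exchange : ∀ {U S T : Subset m} {a b} → UpwardClosed U → a Fin.≤ b →
                    S ─ T ≡ ⁅ a ⁆ → T ─ S ≡ ⁅ b ⁆ → ∣ U ∩ S ∣ ≤ ∣ U ∩ T ∣
∣∩∣-mono-exchange {U = U} {S} {T} {a} {b} up a≤b S─T≡a T─S≡b =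
  +-cancelʳ-≤ _ _ _ (begin
    ∣ U ∩ S ∣ + ∣ U ∩ ⁅ a ⁆ ∣    ≤⟨ +-monoʳ-≤ ∣ U ∩ S ∣ (∣∩⁅⁆∣-mono up a≤b) ⟩
    ∣ U ∩ S ∣ + ∣ U ∩ ⁅ b ⁆ ∣    ≡⟨ cong (λ V → ∣ U ∩ S ∣ + ∣ U ∩ V ∣) T─S≡b ⟨
    ∣ U ∩ S ∣ + ∣ U ∩ (T ─ S) ∣  ≡⟨ ∣∩─∣-exchange U S T ⟩
    ∣ U ∩ T ∣ + ∣ U ∩ (S ─ T) ∣  ≡⟨ cong (λ V → ∣ U ∩ T ∣ + ∣ U ∩ V ∣) S─T≡a ⟩
    ∣ U ∩ T ∣ + ∣ U ∩ ⁅ a ⁆ ∣    ∎)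
  where open ≤-Reasoning

upFrom : Fin m → Subset m
upFrom zero = ⊤
upFrom (suc q) = outside ∷ upFrom q

∈upFrom⁺ : ∀ {q z : Fin m} → q Fin.≤ z → z ∈ upFrom q
∈upFrom⁺ {q = zero} _ = ∈⊤
∈upFrom⁺ {q = suc q} {z = suc z} (s≤s q≤z) = there (∈upFrom⁺ q≤z)

∈upFrom⁻ : ∀ {q z : Fin m} → z ∈ upFrom q → q Fin.≤ z
∈upFrom⁻ {q = zero} _ = z≤n
∈upFrom⁻ {q = suc q} (there z∈) = s≤s (∈upFrom⁻ z∈)

upFrom-upwardClosed : (q : Fin m) → UpwardClosed (upFrom q)
upFrom-upwardClosed q a≤b a∈ = ∈upFrom⁺ (≤-trans (∈upFrom⁻ {q = q} a∈) a≤b)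

m<o<2+m⇒o≡1+m : ∀ {m o} → m < o → o < suc (suc m) → o ≡ suc m
m<o<2+m⇒o≡1+m m<o o<2+m = ≤-antisym (≤-pred o<2+m) m<o

ZeroOrOne : Set → ℕ → Set
ZeroOrOne P w = w ≡ 0 ⊎ (w ≡ 1 × P)

ZeroOrOne-map : ∀ {P Q : Set} {w} → (P → Q) → ZeroOrOne P w → ZeroOrOne Q w
ZeroOrOne-map f = Sum.map₂ (Product.map₂ f)

ZeroOrOne-+ : ∀ {P Q : Set} {w w′} → (P → Q → ⊥) →
              ZeroOrOne P w → ZeroOrOne Q w′ → ZeroOrOne (P ⊎ Q) (w + w′)
ZeroOrOne-+ _ (inj₁ refl) zq = ZeroOrOne-map inj₂ zq
ZeroOrOne-+ _ (inj₂ (refl , p)) (inj₁ refl) = inj₂ (refl , inj₁ p)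
ZeroOrOne-+ exclusive (inj₂ (_ , p)) (inj₂ (_ , q)) = ⊥-elim (exclusive p q)

sum-positive⇒Any : ∀ {I : Set} {w : I → ℕ} {E : I → Set} {is : List I} →
                   All (λ i → ZeroOrOne (E i) (w i)) is → 0 < sum (map w is) → Any E is
sum-positive⇒Any {w = w} {is = _ ∷ is} (inj₁ wi≡0 ∷ zos) pos =
  Any.there (sum-positive⇒Any zos (subst (λ k → 0 < k + sum (map w is)) wi≡0 pos))
sum-positive⇒Any (inj₂ (_ , Ei) ∷ _) _ = Any.here Ei

sum≤1 : ∀ {I : Set} {w : I → ℕ} {E : I → Set} {is : List I} → Unique is →
        All (λ i → ZeroOrOne (E i) (w i)) is → (∀ {i j} → E i → E j → i ≡ j) →
        sum (map w is) ≤ 1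
sum≤1 [] [] _ = z≤n
sum≤1 (_ ∷ unique) (inj₁ wi≡0 ∷ zos) once rewrite wi≡0 = sum≤1 unique zos once
sum≤1 {w = w} {is = _ ∷ is} (i∉is ∷ _) (inj₂ (wi≡1 , Ei) ∷ zos) once
  = ≤-reflexive (cong₂ _+_ wi≡1 rest≡0)
  where
  rest≡0 : sum (map w is) ≡ 0
  rest≡0 = n≤0⇒n≡0 (≮⇒≥ λ pos →
    let i≢j , Ej = lookupAny i∉is (sum-positive⇒Any zos pos) in i≢j (once Ei Ej))

concatMapL-map : ∀ {A B C : Set} (f : B → List C) (g : A → B) (xs : List A) →
                 concatMapL f (map g xs) ≡ concatMapL (f ∘ g) xs
concatMapL-map f g [] = refl
concatMapL-map f g (x ∷ xs) = cong (f (g x) ++_) (concatMapL-map f g xs)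

map≡concatMapL : ∀ {A B : Set} (f : A → B) (xs : List A) →
                 map f xs ≡ concatMapL (λ x → f x ∷ []) xs
map≡concatMapL f [] = refl
map≡concatMapL f (x ∷ xs) = cong (f x ∷_) (map≡concatMapL f xs)

optionalEdge : ∀ {P : Set} → Dec P → Edge m → List (Edge m)
optionalEdge p? e = if ⌊ p? ⌋ then [] else e ∷ []

module _ {n : ℕ} (u v : Fin n) where

  multiplicity-++ : (es fs : List (Edge n)) →
                    multiplicity (es ++ fs) u v ≡ multiplicity es u v + multiplicity fs u v
  multiplicity-++ [] fs = refl
  multiplicity-++ (e ∷ es) fs =
    trans (cong (e-count +_) (multiplicity-++ es fs)) (sym (+-assoc e-count _ _))
    where e-count = if joins e u v then 1 else 0

  multiplicity-concatMapL : ∀ {A : Set} (f : A → List (Edge n)) (xs : List A) →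
    multiplicity (concatMapL f xs) u v ≡ sum (map (λ x → multiplicity (f x) u v) xs)
  multiplicity-concatMapL f [] = refl
  multiplicity-concatMapL f (x ∷ xs) =
    trans (multiplicity-++ (f x) _) (cong (_ +_) (multiplicity-concatMapL f xs))

  multiplicity-map : ∀ {A : Set} (f : A → Edge n) (xs : List A) →
    multiplicity (map f xs) u v ≡ sum (map (λ x → multiplicity (f x ∷ []) u v) xs)
  multiplicity-map f xs =
    trans (cong (λ es → multiplicity es u v) (map≡concatMapL f xs))
          (multiplicity-concatMapL _ xs)

  joins-comm : (a b : Fin n) → joins (a , b) u v ≡ joins (b , a) u v
  joins-comm a b = trans (∨-comm (a≟u ∧ b≟v) _) (cong₂ _∨_ (∧-comm a≟v b≟u) (∧-comm a≟u b≟v))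
    where
    a≟u = ⌊ a Fin.≟ u ⌋
    a≟v = ⌊ a Fin.≟ v ⌋
    b≟u = ⌊ b Fin.≟ u ⌋
    b≟v = ⌊ b Fin.≟ v ⌋

  joins⇒ends : ∀ {a b} → joins (a , b) u v ≡ true → (a ≡ u × b ≡ v) ⊎ (a ≡ v × b ≡ u)
  joins⇒ends {a} {b} j =
    Sum.map witnesses witnesses
      (Equivalence.to (T-∨ {⌊ a Fin.≟ u ⌋ ∧ ⌊ b Fin.≟ v ⌋}) (Equivalence.from T-≡ j))
    where
    witnesses : ∀ {p q r s : Fin n} → T (⌊ p Fin.≟ r ⌋ ∧ ⌊ q Fin.≟ s ⌋) → p ≡ r × q ≡ s
    witnesses {p} {q} {r} {s} t with tp , tq ← Equivalence.to (T-∧ {⌊ p Fin.≟ r ⌋}) t =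
      toWitness {a? = p Fin.≟ r} tp , toWitness {a? = q Fin.≟ s} tq

  edge-weight : (e : Edge n) → ZeroOrOne (joins e u v ≡ true) (multiplicity (e ∷ []) u v)
  edge-weight e with joins e u v
  ... | true = inj₂ (refl , refl)
  ... | false = inj₁ refl

  optional-edge-weight : ∀ {P : Set} (d : Dec P) (e : Edge n) →
    ZeroOrOne (¬ P × joins e u v ≡ true) (multiplicity (optionalEdge d e) u v)
  optional-edge-weight (yes _) e = inj₁ refl
  optional-edge-weight (no ¬p) e = ZeroOrOne-map (¬p ,_) (edge-weight e)

module MonotoneWSPathProperties {n k N : ℕ} {A : ℕ → Subset n} {x y : ℕ → Fin n}
                                (P : MonotoneWSPath n k N A x y) where

  open MonotoneWSPath P

  private
    variable
      i j r s t s′ t′ : ℕ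

    entered : i < N → x (suc i) ∈ A (suc i) ─ A i
    entered {i} i<N = subst (_ ∈_) (sym (stepIn (suc i) (s≤s z≤n) i<N)) (x∈⁅x⁆ _)

    left : i < N → y (suc i) ∈ A i ─ A (suc i)
    left {i} i<N = subst (_ ∈_) (sym (stepOut (suc i) (s≤s z≤n) i<N)) (x∈⁅x⁆ _)

  x∉A-before : i < N → x (suc i) ∉ A i
  x∉A-before {i} i<N = x∈p─q⇒x∉q (A (suc i)) (A i) (entered i<N)

  x∈A-after : i < N → x (suc i) ∈ A (suc i)
  x∈A-after {i} i<N = p─q⊆p (A (suc i)) (A i) (entered i<N)

  y∈A-before : i < N → y (suc i) ∈ A i
  y∈A-before {i} i<N = p─q⊆p (A i) (A (suc i)) (left i<N)

  y∉A-after : i < N → y (suc i) ∉ A (suc i)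
  y∉A-after {i} i<N = x∈p─q⇒x∉q (A i) (A (suc i)) (left i<N)

  y≢x : i < N → y (suc i) ≢ x (suc i)
  y≢x i<N = Fin.<⇒≢ (stepUp (suc _) (s≤s z≤n) i<N)

  y≢next-y : suc i < N → y (suc i) ≢ y (suc (suc i))
  y≢next-y {i} 1+i<N y≡y′ =
    y∉A-after (<-trans (n<1+n i) 1+i<N) (subst (_∈ A (suc i)) (sym y≡y′) (y∈A-before 1+i<N))

  ∈A-after : ∀ {z} → i < N → z ∈ A i → z ≢ y (suc i) → z ∈ A (suc i)
  ∈A-after {i} {z} i<N z∈ z≢y with z ∈? A (suc i)
  ... | yes z∈′ = z∈′
  ... | no z∉′ = contradiction (x∈⁅y⁆⇒x≡y _ z∈⁅y⁆) z≢y
    where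
    z∈⁅y⁆ = subst (z ∈_) (stepOut (suc i) (s≤s z≤n) i<N) (x∈p∧x∉q⇒x∈p─q z∈ z∉′)

  ∈A-before : ∀ {z} → i < N → z ∈ A (suc i) → z ≢ x (suc i) → z ∈ A i
  ∈A-before {i} {z} i<N z∈ z≢x with z ∈? A i
  ... | yes z∈′ = z∈′
  ... | no z∉′ = contradiction (x∈⁅y⁆⇒x≡y _ z∈⁅x⁆) z≢x
    where
    z∈⁅x⁆ = subst (z ∈_) (stepIn (suc i) (s≤s z≤n) i<N) (x∈p∧x∉q⇒x∈p─q z∈ z∉′)

  ∣∩A∣-mono : ∀ {U} → UpwardClosed U → i ≤ j → j ≤ N → ∣ U ∩ A i ∣ ≤ ∣ U ∩ A j ∣
  ∣∩A∣-mono {j = zero} up z≤n _ = ≤-refl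
  ∣∩A∣-mono {i} {suc j} up i≤1+j 1+j≤N with m≤n⇒m<n∨m≡n i≤1+j
  ... | inj₂ refl = ≤-refl
  ... | inj₁ (s≤s i≤j) = ≤-trans (∣∩A∣-mono up i≤j (<⇒≤ 1+j≤N))
    (∣∩∣-mono-exchange up (<⇒≤ (stepUp (suc j) (s≤s z≤n) 1+j≤N))
                          (stepOut (suc j) (s≤s z≤n) 1+j≤N) (stepIn (suc j) (s≤s z≤n) 1+j≤N))

  -- Weak separation would force A i ∩ [q, n] ⊃ A j ∩ [q, n], against monotonicity.
  no-downward-swap : ∀ {p q} → i ≤ j → j ≤ N → p Fin.< q →
                     q ∈ A i → p ∉ A i → p ∈ A j → q ∉ A j → ⊥
  no-downward-swap {i} {j} {p} {q} i≤j j≤N p<q q∈i p∉i p∈j q∉j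
    with pairwiseWS i j (≤-trans i≤j j≤N) j≤N
  ... | inj₁ i<j = Fin.<-asym p<q (i<j q p (x∈p∧x∉q⇒x∈p─q q∈i q∉j) (x∈p∧x∉q⇒x∈p─q p∈j p∉i))
  ... | inj₂ j<i = <⇒≱ (p⊂q⇒∣p∣<∣q∣ upper-part-shrinks) (∣∩A∣-mono (upFrom-upwardClosed q) i≤j j≤N)
    where
    upper-part-shrinks : upFrom q ∩ A j ⊂ upFrom q ∩ A i
    upper-part-shrinks =
      upper-part-⊆ , q , x∈p∩q⁺ (∈upFrom⁺ ≤-refl , q∈i) , q∉j ∘ proj₂ ∘ x∈p∩q⁻ _ (A j)
      where
      upper-part-⊆ : upFrom q ∩ A j ⊆ upFrom q ∩ A i
      upper-part-⊆ {z} z∈ with z∈up , z∈j ← x∈p∩q⁻ (upFrom q) (A j) z∈ with z ∈? A i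
      ... | yes z∈i = x∈p∩q⁺ (z∈up , z∈i)
      ... | no z∉i = ⊥-elim (<⇒≱ (j<i z q (x∈p∧x∉q⇒x∈p─q z∈j z∉i) (x∈p∧x∉q⇒x∈p─q q∈i q∉j))
                                  (∈upFrom⁻ z∈up))

  record Exchange (a b : Fin n) (s t : ℕ) : Set where
    field
      s<t : s < t
      t≤N : t ≤ N
      a∈s : a ∈ A s
      b∉s : b ∉ A s
      b∈t : b ∈ A t
      a∉t : a ∉ A t
      between : s < r → r < t → (a ∈ A r ⇔ b ∈ A r)

  open Exchange

  exchange-increasing : ∀ {a b} → Exchange a b s t → a Fin.< b
  exchange-increasing {a = a} {b} e with Fin.<-cmp a b
  ... | tri< a<b _ _ = a<b
  ... | tri≈ _ refl _ = ⊥-elim (b∉s e (a∈s e))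
  ... | tri> _ _ b<a = ⊥-elim (no-downward-swap (<⇒≤ (s<t e)) (t≤N e) b<a
                                                (a∈s e) (b∉s e) (b∈t e) (a∉t e))

  exchange-starts-before-end : ∀ {a b} → Exchange a b s t → Exchange a b s′ t′ → s′ < t
  exchange-starts-before-end e e′ = ≰⇒> λ t≤s′ →
    no-downward-swap t≤s′ (≤-trans (<⇒≤ (s<t e′)) (t≤N e′)) (exchange-increasing e)
                     (b∈t e) (a∉t e) (a∈s e′) (b∉s e′)

  exchange-start-unique : ∀ {a b} → Exchange a b s t → Exchange a b s′ t′ → s ≡ s′
  exchange-start-unique e e′ = ≤-antisym (≮⇒≥ (¬earlier-start e′ e)) (≮⇒≥ (¬earlier-start e e′))
    where
    ¬earlier-start : ∀ {a b s t s′ t′} → Exchange a b s t → Exchange a b s′ t′ → ¬ s < s′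
    ¬earlier-start e e′ s<s′ =
      b∉s e′ (Equivalence.to (between e s<s′ (exchange-starts-before-end e e′)) (a∈s e′))

  exchange-end-unique : ∀ {a b} → Exchange a b s t → Exchange a b s t′ → t ≡ t′
  exchange-end-unique e e′ = ≤-antisym (≮⇒≥ (¬earlier-end e′ e)) (≮⇒≥ (¬earlier-end e e′))
    where
    ¬earlier-end : ∀ {a b s t t′} → Exchange a b s t → Exchange a b s t′ → ¬ t < t′
    ¬earlier-end e e′ t<t′ = a∉t e (Equivalence.from (between e′ (s<t e) t<t′) (b∈t e))

  exchange-unique : ∀ {a b} → Exchange a b s t → Exchange a b s′ t′ → s ≡ s′ × t ≡ t′
  exchange-unique e e′ with refl ← exchange-start-unique e e′ = refl , exchange-end-unique e e′

  UExchange : Fin n → Fin n → ℕ → ℕ → Set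
  UExchange u v s t = Exchange u v s t ⊎ Exchange v u s t

  uexchange-unique : ∀ {u v} → UExchange u v s t → UExchange u v s′ t′ → s ≡ s′ × t ≡ t′
  uexchange-unique (inj₁ e) (inj₁ e′) = exchange-unique e e′
  uexchange-unique (inj₂ e) (inj₂ e′) = exchange-unique e e′
  uexchange-unique (inj₁ e) (inj₂ e′) =
    ⊥-elim (Fin.<-asym (exchange-increasing e) (exchange-increasing e′))
  uexchange-unique (inj₂ e) (inj₁ e′) =
    ⊥-elim (Fin.<-asym (exchange-increasing e) (exchange-increasing e′))

  joined-exchange : ∀ {a b u v} → Exchange a b s t → joins (a , b) u v ≡ true → UExchange u v s t
  joined-exchange {a = a} {b} {u} {v} e j with joins⇒ends u v {a} {b} j
  ... | inj₁ (refl , refl) = inj₁ e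
  ... | inj₂ (refl , refl) = inj₂ e

  black-exchange : i < N → Exchange (y (suc i)) (x (suc i)) i (suc i)
  black-exchange i<N = record
    { s<t = ≤-refl ; t≤N = i<N
    ; a∈s = y∈A-before i<N ; b∉s = x∉A-before i<N ; b∈t = x∈A-after i<N ; a∉t = y∉A-after i<N
    ; between = λ i<r r<1+i → ⊥-elim (<⇒≱ i<r (≤-pred r<1+i)) }

  red-exchange-ad : suc i < N → y (suc i) ≢ x (suc (suc i)) →
                    Exchange (y (suc i)) (x (suc (suc i))) i (suc (suc i))
  red-exchange-ad {i} 1+i<N y≢x = record
    { s<t = m<n⇒m<1+n ≤-refl ; t≤N = 1+i<N
    ; a∈s = y∈A-before i<N
    ; b∉s = λ x∈i → x∉A-before 1+i<N (∈A-after i<N x∈i (≢-sym y≢x))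
    ; b∈t = x∈A-after 1+i<N
    ; a∉t = λ y∈2+i → y∉A-after i<N (∈A-before 1+i<N y∈2+i y≢x)
    ; between = λ i<r r<2+i → subst (λ r → y (suc i) ∈ A r ⇔ x (suc (suc i)) ∈ A r)
        (sym (m<o<2+m⇒o≡1+m i<r r<2+i))
        (mk⇔ (⊥-elim ∘ y∉A-after i<N) (⊥-elim ∘ x∉A-before 1+i<N)) }
    where i<N = <-trans (n<1+n i) 1+i<N

  red-exchange-bc : suc i < N → x (suc i) ≢ y (suc (suc i)) →
                    Exchange (y (suc (suc i))) (x (suc i)) i (suc (suc i))
  red-exchange-bc {i} 1+i<N x≢y = record
    { s<t = m<n⇒m<1+n ≤-refl ; t≤N = 1+i<N
    ; a∈s = ∈A-before i<N (y∈A-before 1+i<N) (≢-sym x≢y)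
    ; b∉s = x∉A-before i<N
    ; b∈t = ∈A-after 1+i<N (x∈A-after i<N) x≢y
    ; a∉t = y∉A-after 1+i<N
    ; between = λ i<r r<2+i → subst (λ r → y (suc (suc i)) ∈ A r ⇔ x (suc i) ∈ A r)
        (sym (m<o<2+m⇒o≡1+m i<r r<2+i))
        (mk⇔ (λ _ → x∈A-after i<N) (λ _ → y∈A-before 1+i<N)) }
    where i<N = <-trans (n<1+n i) 1+i<N

  module _ (u v : Fin n) where

    black-weight : i < N → ZeroOrOne (UExchange u v i (suc i))
                                     (multiplicity ((y (suc i) , x (suc i)) ∷ []) u v)
    black-weight {i} i<N =
      ZeroOrOne-map (joined-exchange (black-exchange i<N)) (edge-weight u v (y (suc i) , x (suc i)))

    red-edges-exclusive : suc i < N →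
      joins (x (suc i) , y (suc (suc i))) u v ≡ true →
      joins (y (suc i) , x (suc (suc i))) u v ≡ true → ⊥
    red-edges-exclusive {i} 1+i<N j₁ j₂ with joins⇒ends u v j₁ | joins⇒ends u v j₂
    ... | inj₁ (x≡u , _) | inj₁ (y≡u , _) = y≢x (<-trans (n<1+n i) 1+i<N) (trans y≡u (sym x≡u))
    ... | inj₁ (_ , y′≡v) | inj₂ (y≡v , _) = y≢next-y 1+i<N (trans y≡v (sym y′≡v))
    ... | inj₂ (_ , y′≡u) | inj₁ (y≡u , _) = y≢next-y 1+i<N (trans y≡u (sym y′≡u))
    ... | inj₂ (x≡v , _) | inj₂ (y≡v , _) = y≢x (<-trans (n<1+n i) 1+i<N) (trans y≡v (sym x≡v))

    red-weight : suc i < N → ZeroOrOne (UExchange u v i (suc (suc i)))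
                                       (multiplicity (redAt x y (suc i)) u v)
    red-weight {i} 1+i<N =
      subst (ZeroOrOne _) (sym (multiplicity-++ u v (optionalEdge (b Fin.≟ c) (b , c))
                                                    (optionalEdge (a Fin.≟ d) (a , d))))
        (ZeroOrOne-map [ bc-exchange , ad-exchange ]
          (ZeroOrOne-+ (λ (_ , bc) (_ , ad) → red-edges-exclusive 1+i<N bc ad)
                       (optional-edge-weight u v (b Fin.≟ c) (b , c))
                       (optional-edge-weight u v (a Fin.≟ d) (a , d))))
      where
      a = y (suc i)
      b = x (suc i)
      c = y (suc (suc i))
      d = x (suc (suc i))
      bc-exchange : b ≢ c × joins (b , c) u v ≡ true → UExchange u v i (suc (suc i))
      bc-exchange (b≢c , joins-bc) =
        joined-exchange (red-exchange-bc 1+i<N b≢c) (trans (joins-comm u v c b) joins-bc)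
      ad-exchange : a ≢ d × joins (a , d) u v ≡ true → UExchange u v i (suc (suc i))
      ad-exchange (a≢d , joins-ad) = joined-exchange (red-exchange-ad 1+i<N a≢d) joins-ad

    black-sum : multiplicity (blackEdges N x y) u v ≡
                sum (map (λ i → multiplicity ((y (suc i) , x (suc i)) ∷ []) u v) (upTo N))
    black-sum = trans (cong (λ es → multiplicity es u v) (sym (map-∘ (upTo N))))
                      (multiplicity-map u v _ (upTo N))

    red-sum : redMult N x y u v ≡
              sum (map (λ i → multiplicity (redAt x y (suc i)) u v) (upTo (N ∸ 1)))
    red-sum = trans (cong (λ es → multiplicity es u v) (concatMapL-map (redAt x y) suc indices))
                    (multiplicity-concatMapL u v (redAt x y ∘ suc) indices)
      where indices = upTo (N ∸ 1)

    black-weights : All (λ i → ZeroOrOne (UExchange u v i (suc i))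
                                         (multiplicity ((y (suc i) , x (suc i)) ∷ []) u v)) (upTo N)
    black-weights = All.tabulate (black-weight ∘ ∈-upTo⁻)

    red-weights : All (λ i → ZeroOrOne (UExchange u v i (suc (suc i)))
                                       (multiplicity (redAt x y (suc i)) u v)) (upTo (N ∸ 1))
    red-weights = All.tabulate (red-weight ∘ <∸1⇒1+< ∘ ∈-upTo⁻)
      where
      <∸1⇒1+< : ∀ {i M} → i < M ∸ 1 → suc i < M
      <∸1⇒1+< {M = suc M} i<M = s≤s i<M

    red≤1 : redMult N x y u v ≤ 1
    red≤1 = ≤-trans (≤-reflexive red-sum)
                    (sum≤1 (upTo⁺ _) red-weights (λ e e′ → proj₁ (uexchange-unique e e′)))

    black⇒no-red : 0 < multiplicity (blackEdges N x y) u v → redMult N x y u v ≡ 0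
    black⇒no-red black-pos = n≤0⇒n≡0 (≮⇒≥ λ red-pos →
      let i , black-i = Any.satisfied
                          (sum-positive⇒Any black-weights (subst (0 <_) black-sum black-pos))
          i′ , red-i′ = Any.satisfied
                          (sum-positive⇒Any red-weights (subst (0 <_) red-sum red-pos))
          i≡i′ , 1+i≡2+i′ = uexchange-unique black-i red-i′
      in 1+n≢n (sym (trans (sym i≡i′) (suc-injective 1+i≡2+i′))))

  bid-simple : BiDSimple n N x y
  bid-simple u v _ with multiplicity (blackEdges N x y) u v | black⇒no-red u v
  ... | suc _ | no-red = inj₁ (refl , no-red z<s)
  ... | zero | _ with redMult N x y u v | red≤1 u v
  ...   | zero | _ = inj₂ (inj₂ (refl , refl))
  ...   | suc zero | _ = inj₂ (inj₁ (refl , refl))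
  ...   | suc (suc _) | s≤s ()

proposition3p14 : (n N : ℕ) → 3 ≤ n → (A : ℕ → Subset n) → (x y : ℕ → Fin n)
    → MonotoneWSPath n 3 N A x y → A 0 ≡ initial3 n → A N ≡ final3 n
    → BiDSimple n N x y
proposition3p14 _ _ _ _ _ _ P _ _ = MonotoneWSPathProperties.bid-simple P
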